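{- Let $V$ be a finite set, $\ell\ge0$ an integer, $w:V^2\to\mathbb{N}$ an $\ell$-bounded symmetric weight function, $X\subseteq V$ nonempty and $f:X\to\{1,\dots,\ell+1\}$. For $v\in X$ define $f_v:X\setminus\{v\}\to\{1,\dots,\ell+1\}$ by $f_v(x)=1+\max\{w(v,x),\,f(x)-f(v)\}$. Then \[T[X,f]=\min_{v\in X}\bigl(f(v)+T[X\setminus\{v\},f_v]-1\bigr).\]
   Context: $\mathbb{N}=\{0,1,2,\dots\}$; $w$ is $\ell$-bounded if $w(x,y)\le\ell$ for all $x,y$. For $X\subseteq V$, an assignment $c:X\to\mathbb{N}$ is proper if $|c(x)-c(y)|\ge w(x,y)$ for all distinct $x,y\in X$. For $f:X\to\{1,\dots,\ell+1\}$, $\mathcal{A}_{X,f}$ is the set of proper assignments $c:X\to\mathbb{N}$ with $c(x)\ge f(x)$ for every $x\in X$. The span of such an assignment is $\max_{x\in X}c(x)$, and by convention the (unique) assignment with empty domain has span $1$. $T[X,f]$ denotes the minimum span of an assignment in $\mathcal{A}_{X,f}$. -}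

module Defs where

open import Data.Nat using (ℕ; zero; suc; _⊔_; _≤_; _∸_; ∣_-_∣)
open import Data.Bool using (Bool; true; false; if_then_else_)
open import Data.Fin using (Fin; zero; suc)
open import Data.Fin.Subset using (Subset; _∈_)
open import Data.Vec using ([]; _∷_)
open import Data.Product using (Σ; _×_)
open import Relation.Binary.PropositionalEquality using (_≡_; _≢_)

-- The finite set V is Fin n; a subset X ⊆ V is a Subset n.
-- Functions X → ℕ are represented as Fin n → ℕ (values outside X are ignored).

Bounded : ∀ {n} → ℕ → (Fin n → Fin n → ℕ) → Set
Bounded ℓ w = ∀ x y → w x y ≤ ℓ

Symmetric : ∀ {n} → (Fin n → Fin n → ℕ) → Set
Symmetric w = ∀ x y → w x y ≡ w y x

InRange : ∀ {n} → ℕ → Subset n → (Fin n → ℕ) → Set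
InRange ℓ X f = ∀ x → x ∈ X → (1 ≤ f x) × (f x ≤ suc ℓ)

Proper : ∀ {n} → (Fin n → Fin n → ℕ) → Subset n → (Fin n → ℕ) → Set
Proper w X c = ∀ x y → x ∈ X → y ∈ X → x ≢ y → w x y ≤ ∣ c x - c y ∣

InA : ∀ {n} → (Fin n → Fin n → ℕ) → Subset n → (Fin n → ℕ) → (Fin n → ℕ) → Set
InA w X f c = Proper w X c × (∀ x → x ∈ X → f x ≤ c x)

maxOn : ∀ {n} → Subset n → (Fin n → ℕ) → ℕ
maxOn {zero} [] c = 0
maxOn {suc n} (b ∷ p) c = (if b then c zero else 0) ⊔ maxOn p (λ i → c (suc i))

isEmptyᵇ : ∀ {n} → Subset n → Bool
isEmptyᵇ [] = true
isEmptyᵇ (true ∷ p) = false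
isEmptyᵇ (false ∷ p) = isEmptyᵇ p

-- span of an assignment on X; by convention 1 when X is empty
span : ∀ {n} → Subset n → (Fin n → ℕ) → ℕ
span X c = if isEmptyᵇ X then 1 else maxOn X c

-- t = T[X,f] : t is the minimum span of an assignment in 𝒜_{X,f}
IsT : ∀ {n} → (Fin n → Fin n → ℕ) → Subset n → (Fin n → ℕ) → ℕ → Set
IsT w X f t =
  (Σ (_ → ℕ) λ c → InA w X f c × span X c ≡ t)
  × (∀ c → InA w X f c → t ≤ span X c)

-- f_v(x) = 1 + max{w(v,x), f(x) - f(v)}  (truncated subtraction is harmless
-- since w(v,x) ≥ 0)
fᵥ : ∀ {n} → (Fin n → Fin n → ℕ) → (Fin n → ℕ) → Fin n → Fin n → ℕ
fᵥ w f v x = suc (w v x ⊔ (f x ∸ f v))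

module Submission where

-- Let c be an optimal assignment for (X, f) and v a point where c is smallest. Since
-- c(x) ≥ c(v) + w(v,x) and c(x) ≥ f(x), lowering every value by f(v) − 1 and deleting v
-- leaves an assignment for (X ∖ {v}, f_v). Conversely an assignment c' for (X ∖ {v}, f_v)
-- extends to X by c(v) = f(v) and c(x) = c'(x) + f(v) − 1. Both operations shift the
-- span by exactly f(v) − 1. As f_v ≥ 1 again, the recurrence also yields the existence
-- of T[X, f] by induction on |X|.

open import Defs
open import Data.Nat using (ℕ; zero; suc; pred; _≤_; _+_; _∸_; _⊔_; z≤n; s≤s; ∣_-_∣)
open import Data.Nat.Properties hiding (_≟_)
open import Data.Fin using (Fin; zero; suc)
open import Data.Fin.Properties using (_≟_)
open import Data.Fin.Subset using (Subset; _∈_; _∉_; _-_; _─_; ⁅_⁆; Nonempty; Empty; outside; inside)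
import Data.Fin.Subset as Subset
open import Data.Fin.Subset.Properties
  using (nonempty?; drop-∷-Empty; p─q⊆p; x∈⁅x⁆; x∈p∧x≢y⇒x∈p-y; x∈p⇒∣p-x∣<∣p∣)
open import Data.Bool using (true; false; if_then_else_)
open import Data.Vec using ([]; _∷_; here; there)
open import Data.Product using (Σ; _×_; _,_; proj₁; proj₂)
open import Data.Empty using (⊥-elim)
open import Relation.Nullary using (yes; no)
open import Relation.Binary.PropositionalEquality
  using (_≡_; _≢_; refl; sym; trans; cong; cong₂; module ≡-Reasoning)

private
  variable
    n : ℕ

x∈p─q⇒x∉q : {x : Fin n} (p q : Subset n) → x ∈ p ─ q → x ∉ q
x∈p─q⇒x∉q (inside ∷ p) (outside ∷ q) here ()
x∈p─q⇒x∉q (_ ∷ p) (_ ∷ q) (there x∈p─q) (there x∈q) = x∈p─q⇒x∉q p q x∈p─q x∈q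

x∈p-y⇒x∈p : {x : Fin n} {p : Subset n} {y : Fin n} → x ∈ p - y → x ∈ p
x∈p-y⇒x∈p {p = p} {y} = p─q⊆p p ⁅ y ⁆

x∈p-y⇒x≢y : {x : Fin n} {p : Subset n} {y : Fin n} → x ∈ p - y → x ≢ y
x∈p-y⇒x≢y {p = p} {y} x∈p-y refl = x∈p─q⇒x∉q p ⁅ y ⁆ x∈p-y (x∈⁅x⁆ y)

argmin : (X : Subset n) → Nonempty X → (g : ∀ v → v ∈ X → ℕ) →
  Σ (Fin n) λ v → Σ (v ∈ X) λ v∈X → ∀ u (u∈X : u ∈ X) → g v v∈X ≤ g u u∈X
argmin (b ∷ p) ne g with nonempty? p
argmin (b ∷ p) (zero , here) g | no p-empty =
  zero , here , λ { zero here → ≤-refl ; (suc u) (there u∈p) → ⊥-elim (p-empty (u , u∈p)) }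
argmin (b ∷ p) (suc x , there x∈p) g | no p-empty = ⊥-elim (p-empty (x , x∈p))
argmin (b ∷ p) ne g | yes p-ne with argmin p p-ne (λ u u∈p → g (suc u) (there u∈p))
argmin (outside ∷ p) ne g | yes p-ne | v , v∈p , min-p =
  suc v , there v∈p , λ { (suc u) (there u∈p) → min-p u u∈p }
argmin (inside ∷ p) ne g | yes p-ne | v , v∈p , min-p with g zero here ≤? g (suc v) (there v∈p)
... | yes g0≤ = zero , here , λ { zero here → ≤-refl ; (suc u) (there u∈p) → ≤-trans g0≤ (min-p u u∈p) }
... | no g0≰ = suc v , there v∈p , λ { zero here → ≰⇒≥ g0≰ ; (suc u) (there u∈p) → min-p u u∈p }

maxOn-upperBound : ∀ (X : Subset n) c {x} → x ∈ X → c x ≤ maxOn X c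
maxOn-upperBound (inside ∷ p) c here = m≤m⊔n _ _
maxOn-upperBound (_ ∷ p) c (there x∈p) = ≤-trans (maxOn-upperBound p (λ i → c (suc i)) x∈p) (m≤n⊔m _ _)

maxOn-least : ∀ (X : Subset n) c {m} → (∀ x → x ∈ X → c x ≤ m) → maxOn X c ≤ m
maxOn-least [] c bound = z≤n
maxOn-least (inside ∷ p) c bound =
  ⊔-lub (bound zero here) (maxOn-least p _ (λ x x∈p → bound (suc x) (there x∈p)))
maxOn-least (outside ∷ p) c bound = maxOn-least p _ (λ x x∈p → bound (suc x) (there x∈p))

maxOn-cong : ∀ (X : Subset n) {c c′} → (∀ x → x ∈ X → c x ≡ c′ x) → maxOn X c ≡ maxOn X c′
maxOn-cong [] eq = refl
maxOn-cong (inside ∷ p) eq = cong₂ _⊔_ (eq zero here) (maxOn-cong p (λ x x∈p → eq (suc x) (there x∈p)))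
maxOn-cong (outside ∷ p) eq = maxOn-cong p (λ x x∈p → eq (suc x) (there x∈p))

isEmptyᵇ-nonempty : (X : Subset n) → Nonempty X → isEmptyᵇ X ≡ false
isEmptyᵇ-nonempty (inside ∷ p) _ = refl
isEmptyᵇ-nonempty (outside ∷ p) (suc x , there x∈p) = isEmptyᵇ-nonempty p (x , x∈p)

isEmptyᵇ-empty : (X : Subset n) → Empty X → isEmptyᵇ X ≡ true
isEmptyᵇ-empty [] _ = refl
isEmptyᵇ-empty (inside ∷ p) empty = ⊥-elim (empty (zero , here))
isEmptyᵇ-empty (outside ∷ p) empty = isEmptyᵇ-empty p (drop-∷-Empty empty)

span-nonempty : ∀ (X : Subset n) c → Nonempty X → span X c ≡ maxOn X c
span-nonempty X c ne rewrite isEmptyᵇ-nonempty X ne = refl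

span-empty : ∀ (X : Subset n) c → Empty X → span X c ≡ 1
span-empty X c empty rewrite isEmptyᵇ-empty X empty = refl

span-upperBound : ∀ (X : Subset n) c {x} → x ∈ X → c x ≤ span X c
span-upperBound X c {x} x∈X rewrite span-nonempty X c (x , x∈X) = maxOn-upperBound X c x∈X

span-least : ∀ (X : Subset n) c {m} → 1 ≤ m → (∀ x → x ∈ X → c x ≤ m) → span X c ≤ m
span-least X c 1≤m bound with nonempty? X
... | yes ne rewrite span-nonempty X c ne = maxOn-least X c bound
... | no empty rewrite span-empty X c empty = 1≤m

span-positive : ∀ (X : Subset n) c → (∀ x → x ∈ X → 1 ≤ c x) → 1 ≤ span X c
span-positive X c pos with nonempty? X
... | yes (x , x∈X) = ≤-trans (pos x x∈X) (span-upperBound X c x∈X)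
... | no empty rewrite span-empty X c empty = ≤-refl

span-cong : ∀ (X : Subset n) {c c′} → (∀ x → x ∈ X → c x ≡ c′ x) → span X c ≡ span X c′
span-cong X eq = cong (λ m → if isEmptyᵇ X then 1 else m) (maxOn-cong X eq)

span-lower : ∀ (X : Subset n) c {v d} → v ∈ X → suc d ≤ c v →
  d + span (X - v) (λ x → c x ∸ d) ≤ span X c
span-lower X c {v} {d} v∈X d<cv = begin
  d + span (X - v) (λ x → c x ∸ d)  ≤⟨ +-monoʳ-≤ d lowered-span ⟩
  d + (span X c ∸ d)                ≡⟨ m+[n∸m]≡n (≤-trans (n≤1+n d) d<span) ⟩
  span X c                          ∎
  where
  open ≤-Reasoning
  d<span : suc d ≤ span X c
  d<span = ≤-trans d<cv (span-upperBound X c v∈X)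
  lowered-span : span (X - v) (λ x → c x ∸ d) ≤ span X c ∸ d
  lowered-span = span-least (X - v) _ (m+n≤o⇒m≤o∸n 1 d<span)
    (λ x x∈ → ∸-monoˡ-≤ d (span-upperBound X c (x∈p-y⇒x∈p x∈)))

+≤⇒≤∣-∣ : ∀ k a b → k + a ≤ b → k ≤ ∣ b - a ∣
+≤⇒≤∣-∣ k a b k+a≤b = ≤-trans (m+n≤o⇒m≤o∸n k k+a≤b) (m∸n≤∣m-n∣ b a)

∣m∸o-n∸o∣≡∣m-n∣ : ∀ m n o → o ≤ m → o ≤ n → ∣ (m ∸ o) - (n ∸ o) ∣ ≡ ∣ m - n ∣
∣m∸o-n∸o∣≡∣m-n∣ m n o o≤m o≤n = begin
  ∣ (m ∸ o) - (n ∸ o) ∣          ≡⟨ ∣m+n-m+o∣≡∣n-o∣ o (m ∸ o) (n ∸ o) ⟨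
  ∣ o + (m ∸ o) - o + (n ∸ o) ∣  ≡⟨ cong₂ ∣_-_∣ (m+[n∸m]≡n o≤m) (m+[n∸m]≡n o≤n) ⟩
  ∣ m - n ∣                      ∎
  where open ≡-Reasoning

Positive : Subset n → (Fin n → ℕ) → Set
Positive X f = ∀ x → x ∈ X → 1 ≤ f x

m≡suc[pred[m]] : ∀ {m} → 1 ≤ m → m ≡ suc (pred m)
m≡suc[pred[m]] (s≤s _) = refl

-- With f v ≡ suc d, this is c(v) = f(v) and c(x) = c′(x) + f(v) − 1 for x ≢ v.
extend : Fin n → ℕ → (Fin n → ℕ) → Fin n → ℕ
extend v d c′ x with x ≟ v
... | yes _ = suc d
... | no _ = d + c′ x

extend-at : (v : Fin n) (d : ℕ) (c′ : Fin n → ℕ) → extend v d c′ v ≡ suc d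
extend-at v d c′ with v ≟ v
... | yes _ = refl
... | no v≢v = ⊥-elim (v≢v refl)

extend-other : {v : Fin n} (d : ℕ) (c′ : Fin n → ℕ) {x : Fin n} → x ≢ v → extend v d c′ x ≡ d + c′ x
extend-other {v = v} d c′ {x} x≢v with x ≟ v
... | yes x≡v = ⊥-elim (x≢v x≡v)
... | no _ = refl

module _ (w : Fin n → Fin n → ℕ) (w-sym : Symmetric w) where

  extend-∈A : ∀ X f {v d c′} → f v ≡ suc d → InA w (X - v) (fᵥ w f v) c′ →
    InA w X f (extend v d c′)
  extend-∈A X f {v} {d} {c′} fv≡ (proper′ , above′) = proper , above
    where
    fᵥ≤c′ : ∀ {x} → x ∈ X → x ≢ v → fᵥ w f v x ≤ c′ x
    fᵥ≤c′ x∈X x≢v = above′ _ (x∈p∧x≢y⇒x∈p-y x∈X x≢v)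
    gap : ∀ {x} → x ∈ X → x ≢ v → w v x ≤ ∣ (d + c′ x) - suc d ∣
    gap {x} x∈X x≢v = +≤⇒≤∣-∣ (w v x) (suc d) (d + c′ x) (begin
      w v x + suc d    ≡⟨ +-comm (w v x) (suc d) ⟩
      suc d + w v x    ≡⟨ +-suc d (w v x) ⟨
      d + suc (w v x)  ≤⟨ +-monoʳ-≤ d (≤-trans (s≤s (m≤m⊔n _ _)) (fᵥ≤c′ x∈X x≢v)) ⟩
      d + c′ x         ∎)
      where open ≤-Reasoning
    proper : Proper w X (extend v d c′)
    proper x y x∈X y∈X x≢y with x ≟ v | y ≟ v
    ... | yes refl | yes refl = ⊥-elim (x≢y refl)
    ... | yes refl | no y≢v
      rewrite ∣-∣-comm (suc d) (d + c′ y) = gap y∈X y≢v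
    ... | no x≢v | yes refl
      rewrite w-sym x v = gap x∈X x≢v
    ... | no x≢v | no y≢v
      rewrite ∣m+n-m+o∣≡∣n-o∣ d (c′ x) (c′ y) =
      proper′ x y (x∈p∧x≢y⇒x∈p-y x∈X x≢v) (x∈p∧x≢y⇒x∈p-y y∈X y≢v) x≢y
    above : ∀ x → x ∈ X → f x ≤ extend v d c′ x
    above x x∈X with x ≟ v
    ... | yes refl = ≤-reflexive fv≡
    ... | no x≢v = begin
      f x                      ≤⟨ m≤n+m∸n (f x) (f v) ⟩
      f v + (f x ∸ f v)        ≡⟨ cong (_+ (f x ∸ f v)) fv≡ ⟩
      suc d + (f x ∸ f v)      ≡⟨ +-suc d (f x ∸ f v) ⟨
      d + suc (f x ∸ f v)      ≤⟨ +-monoʳ-≤ d (≤-trans (s≤s (m≤n⊔m _ _)) (fᵥ≤c′ x∈X x≢v)) ⟩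
      d + c′ x                 ∎
      where open ≤-Reasoning

  span-extend : ∀ X f {v d c′} → v ∈ X → InA w (X - v) (fᵥ w f v) c′ →
    span X (extend v d c′) ≡ d + span (X - v) c′
  span-extend X f {v} {d} {c′} v∈X (_ , above′) = ≤-antisym upper lower
    where
    s = span (X - v) c′
    1≤s : 1 ≤ s
    1≤s = span-positive (X - v) c′ (λ x x∈ → ≤-trans (s≤s z≤n) (above′ x x∈))
    upper : span X (extend v d c′) ≤ d + s
    upper = span-least X _ (≤-trans 1≤s (m≤n+m s d)) bound
      where
      bound : ∀ x → x ∈ X → extend v d c′ x ≤ d + s
      bound x x∈X with x ≟ v
      ... | yes refl = ≤-trans (≤-reflexive (+-comm 1 d)) (+-monoʳ-≤ d 1≤s)
      ... | no x≢v =
        +-monoʳ-≤ d (span-upperBound (X - v) c′ (x∈p∧x≢y⇒x∈p-y x∈X x≢v))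
    lower : d + s ≤ span X (extend v d c′)
    lower = begin
      d + s                                               ≡⟨ cong (d +_) (span-cong (X - v) restrict) ⟨
      d + span (X - v) (λ x → extend v d c′ x ∸ d)       ≤⟨ span-lower X _ v∈X (≤-reflexive (sym (extend-at v d c′))) ⟩
      span X (extend v d c′)                              ∎
      where
      open ≤-Reasoning
      restrict : ∀ x → x ∈ X - v → extend v d c′ x ∸ d ≡ c′ x
      restrict x x∈ = trans (cong (_∸ d) (extend-other d c′ (x∈p-y⇒x≢y x∈))) (m+n∸m≡n d (c′ x))

  lower-∈A : ∀ X f c {v d} → InA w X f c → v ∈ X → (∀ u → u ∈ X → c v ≤ c u) → f v ≡ suc d →
    InA w (X - v) (fᵥ w f v) (λ x → c x ∸ d)
  lower-∈A X f c {v} {d} (proper , above) v∈X minimal fv≡ = proper′ , above′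
    where
    d≤c : ∀ {x} → x ∈ X → d ≤ c x
    d≤c x∈X = ≤-trans (n≤1+n d) (≤-trans (≤-reflexive (sym fv≡)) (≤-trans (above _ v∈X) (minimal _ x∈X)))
    proper′ : Proper w (X - v) (λ x → c x ∸ d)
    proper′ x y x∈ y∈ x≢y
      rewrite ∣m∸o-n∸o∣≡∣m-n∣ (c x) (c y) d (d≤c (x∈p-y⇒x∈p x∈)) (d≤c (x∈p-y⇒x∈p y∈)) =
      proper x y (x∈p-y⇒x∈p x∈) (x∈p-y⇒x∈p y∈) x≢y
    above′ : ∀ x → x ∈ X - v → fᵥ w f v x ≤ c x ∸ d
    above′ x x∈ = m+n≤o⇒m≤o∸n (fᵥ w f v x) (begin
      suc (w v x ⊔ (f x ∸ f v)) + d  ≡⟨ +-suc (w v x ⊔ (f x ∸ f v)) d ⟨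
      (w v x ⊔ (f x ∸ f v)) + suc d  ≡⟨ cong ((w v x ⊔ (f x ∸ f v)) +_) fv≡ ⟨
      (w v x ⊔ (f x ∸ f v)) + f v    ≤⟨ m≤o∸n⇒m+n≤o _ fv≤cx (⊔-lub weight-gap bound-gap) ⟩
      c x                            ∎)
      where
      open ≤-Reasoning
      x∈X = x∈p-y⇒x∈p x∈
      cv≤cx = minimal x x∈X
      fv≤cx = ≤-trans (above v v∈X) cv≤cx
      weight-gap : w v x ≤ c x ∸ f v
      weight-gap = ≤-trans (proper v x v∈X x∈X (λ v≡x → x∈p-y⇒x≢y x∈ (sym v≡x)))
        (≤-trans (≤-reflexive (m≤n⇒∣m-n∣≡n∸m cv≤cx)) (∸-monoʳ-≤ (c x) (above v v∈X)))
      bound-gap : f x ∸ f v ≤ c x ∸ f v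
      bound-gap = ∸-monoˡ-≤ (f v) (above x x∈X)

  RecurrenceHolds : Subset n → (Fin n → ℕ) → ℕ → Set
  RecurrenceHolds X f t =
    (Σ (Fin n) λ v → v ∈ X × Σ ℕ λ s → IsT w (X - v) (fᵥ w f v) s × t ≡ f v + s ∸ 1)
    × (∀ v → v ∈ X → ∀ s → IsT w (X - v) (fᵥ w f v) s → t ≤ f v + s ∸ 1)

  term-attained : ∀ X f {v s} → 1 ≤ f v → v ∈ X → IsT w (X - v) (fᵥ w f v) s →
    Σ (Fin n → ℕ) λ c → InA w X f c × span X c ≡ f v + s ∸ 1
  term-attained X f {v} {s} 1≤fv v∈X ((c′ , c′∈A , span≡s) , _) =
    extend v d c′ , extend-∈A X f fv≡ c′∈A , (begin
      span X (extend v d c′)  ≡⟨ span-extend X f v∈X c′∈A ⟩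
      d + span (X - v) c′     ≡⟨ cong (d +_) span≡s ⟩
      d + s                   ≡⟨ cong (λ m → m + s ∸ 1) fv≡ ⟨
      f v + s ∸ 1             ∎)
    where
    open ≡-Reasoning
    d = pred (f v)
    fv≡ : f v ≡ suc d
    fv≡ = m≡suc[pred[m]] 1≤fv

  term-≤-span : ∀ X f c {v s} → 1 ≤ f v → InA w X f c → v ∈ X →
    (∀ u → u ∈ X → c v ≤ c u) → IsT w (X - v) (fᵥ w f v) s → f v + s ∸ 1 ≤ span X c
  term-≤-span X f c {v} {s} 1≤fv c∈A v∈X minimal (_ , s-least) = begin
    f v + s ∸ 1                           ≡⟨ cong (λ m → m + s ∸ 1) fv≡ ⟩
    d + s                                 ≤⟨ +-monoʳ-≤ d (s-least _ (lower-∈A X f c c∈A v∈X minimal fv≡)) ⟩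
    d + span (X - v) (λ x → c x ∸ d)      ≤⟨ span-lower X c v∈X (≤-trans (≤-reflexive (sym fv≡)) (proj₂ c∈A v v∈X)) ⟩
    span X c                              ∎
    where
    open ≤-Reasoning
    d = pred (f v)
    fv≡ : f v ≡ suc d
    fv≡ = m≡suc[pred[m]] 1≤fv

  recurrence : ∀ X f → Nonempty X → Positive X f →
    (T : ∀ v → v ∈ X → Σ ℕ (IsT w (X - v) (fᵥ w f v))) →
    Σ ℕ λ t → IsT w X f t × RecurrenceHolds X f t
  recurrence X f ne pos T =
    term v₀ v₀∈X , (attained v₀∈X (proj₂ (T v₀ v₀∈X)) , least) , (v₀ , v₀∈X , _ , proj₂ (T v₀ v₀∈X) , refl) , below
    where
    term : ∀ v → v ∈ X → ℕ
    term v v∈X = f v + proj₁ (T v v∈X) ∸ 1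
    minimum = argmin X ne term
    v₀ = proj₁ minimum
    v₀∈X = proj₁ (proj₂ minimum)
    attained : ∀ {v s} → v ∈ X → IsT w (X - v) (fᵥ w f v) s →
      Σ (Fin n → ℕ) λ c → InA w X f c × span X c ≡ f v + s ∸ 1
    attained v∈X = term-attained X f (pos _ v∈X) v∈X
    least : ∀ c → InA w X f c → term v₀ v₀∈X ≤ span X c
    least c c∈A with argmin X ne (λ v _ → c v)
    ... | v , v∈X , minimal = ≤-trans (proj₂ (proj₂ minimum) v v∈X)
      (term-≤-span X f c (pos v v∈X) c∈A v∈X minimal (proj₂ (T v v∈X)))
    below : ∀ v → v ∈ X → ∀ s → IsT w (X - v) (fᵥ w f v) s → term v₀ v₀∈X ≤ f v + s ∸ 1
    below v v∈X s T-s with attained v∈X T-s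
    ... | c , c∈A , span≡ = ≤-trans (least c c∈A) (≤-reflexive span≡)

  T-exists : ∀ k X f → Subset.∣ X ∣ ≤ k → Positive X f → Σ ℕ (IsT w X f)
  T-exists k X f size≤ pos with nonempty? X
  ... | no empty =
    1 , ((λ _ → 0) , ((λ x _ x∈X → ⊥-elim (empty (x , x∈X))) , (λ x x∈X → ⊥-elim (empty (x , x∈X))))
      , span-empty X _ empty) , (λ c _ → ≤-reflexive (sym (span-empty X c empty)))
  T-exists zero X f size≤ pos | yes (x , x∈X) with ≤-trans (x∈p⇒∣p-x∣<∣p∣ x∈X) size≤
  ... | ()
  T-exists (suc k) X f size≤ pos | yes ne = proj₁ t , proj₁ (proj₂ t)
    where
    t = recurrence X f ne pos (λ v v∈X → T-exists k (X - v) (fᵥ w f v)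
          (≤-pred (≤-trans (x∈p⇒∣p-x∣<∣p∣ v∈X) size≤)) (λ _ _ → s≤s z≤n))

lemma1 : (n ℓ : ℕ) (w : Fin n → Fin n → ℕ) → Bounded ℓ w → Symmetric w →
    (X : Subset n) → Nonempty X → (f : Fin n → ℕ) → InRange ℓ X f →
    Σ ℕ λ t → IsT w X f t
    × (Σ (Fin n) λ v → v ∈ X × Σ ℕ λ s → IsT w (X - v) (fᵥ w f v) s × t ≡ f v + s ∸ 1)
    × (∀ v → v ∈ X → ∀ s → IsT w (X - v) (fᵥ w f v) s → t ≤ f v + s ∸ 1)
lemma1 n ℓ w _ w-sym X ne f f-range = recurrence w w-sym X f ne f-positive T-removed
  where
  f-positive : Positive X f
  f-positive x x∈X = proj₁ (f-range x x∈X)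
  T-removed : ∀ v → v ∈ X → Σ ℕ (IsT w (X - v) (fᵥ w f v))
  T-removed v _ = T-exists w w-sym _ (X - v) (fᵥ w f v) ≤-refl (λ _ _ → s≤s z≤n)
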